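{- For all integers $j,k\ge2$ with $j\neq k$ and all integers $m\ge1$, $n\ge1$, $$G(m\vec j+n\vec k)=\sum_{i=0}^{n}(-1)^i\,C\big((m+1+i)\vec j+(n-i)\vec k\big).$$
   Context: A type is a vector $\mathbf m=[m_2,m_3,\ldots]$ of natural numbers (indices start at $2$) with finitely many nonzero entries; $\vec j$ is the type with $1$ in position $j$ and $0$ elsewhere, and $\mathbf t^{\mathbf m}=t_2^{m_2}t_3^{m_3}\cdots$. The hyper-Catalan number is $C(\mathbf m)=C_{\mathbf m}=\frac{(2m_2+3m_3+4m_4+\cdots)!}{(1+m_2+2m_3+3m_4+\cdots)!\,m_2!\,m_3!\cdots}$ and $\mathbf S=\sum_{\mathbf m}C_{\mathbf m}\mathbf t^{\mathbf m}$. The Geode $\mathbf G$ is the unique formal power series with $\mathbf S-1=(t_2+t_3+t_4+\cdots)\mathbf G$, and $G(\mathbf n)$ is its coefficient of $\mathbf t^{\mathbf n}$. -}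

module Defs where

open import Data.Nat as ℕ using (ℕ; zero; suc; _!; _∸_; NonZero)
open import Data.Nat.Properties using (_!≢0; m*n≢0)
open import Data.Nat.DivMod using (_/_)
open import Data.List as List using (List; []; _∷_; map; foldr; upTo; length; replicate; _++_)
open import Data.Integer as ℤ using (ℤ; +_)
open import Relation.Binary.PropositionalEquality using (_≡_)

HType : Set
HType = List ℕ

-- m_{p+2}, defaulting to 0 beyond the list
entry : HType → ℕ → ℕ
entry []       _       = 0
entry (x ∷ _)  zero    = x
entry (_ ∷ xs) (suc p) = entry xs p

wsum : ℕ → HType → ℕ
wsum c []       = 0
wsum c (x ∷ xs) = c ℕ.* x ℕ.+ wsum (suc c) xs

factProd : HType → ℕ
factProd []       = 1
factProd (x ∷ xs) = x ! ℕ.* factProd xs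

factProd≢0 : ∀ m → NonZero (factProd m)
factProd≢0 []       = _
factProd≢0 (x ∷ xs) = m*n≢0 (x !) (factProd xs) {{x !≢0}} {{factProd≢0 xs}}

denom≢0 : ∀ m → NonZero (suc (wsum 1 m) ! ℕ.* factProd m)
denom≢0 m = m*n≢0 _ _ {{suc (wsum 1 m) !≢0}} {{factProd≢0 m}}

-- hyper-Catalan number
--   C(m) = (2m_2+3m_3+...)! / ((1+m_2+2m_3+...)! m_2! m_3! ...)
-- (the division is exact)
Cat : HType → ℕ
Cat m = ((wsum 2 m) ! / (suc (wsum 1 m) ! ℕ.* factProd m)) {{denom≢0 m}}

-- m - e_{p+2} (decrement entry p; only used when that entry is ≥ 1)
decAt : ℕ → HType → HType
decAt _       []       = []
decAt zero    (x ∷ xs) = x ∸ 1 ∷ xs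
decAt (suc p) (x ∷ xs) = x ∷ decAt p xs

sumℤ : List ℤ → ℤ
sumℤ = foldr ℤ._+_ (+ 0)

-- contribution of t_{p+2} * G to the coefficient of t^m
term : (HType → ℤ) → HType → ℕ → ℤ
term g m p with entry m p
... | zero  = + 0
... | suc _ = g (decAt p m)

-- coefficient of t^m in (t_2 + t_3 + ...) * G, where g gives the
-- coefficients of G
mulSumT : (HType → ℤ) → HType → ℤ
mulSumT g m = sumℤ (map (term g m) (upTo (length m)))

-- coefficient of t^m in the series 1
isZeroType : HType → ℕ
isZeroType []          = 1
isZeroType (zero ∷ xs) = isZeroType xs
isZeroType (suc _ ∷ _) = 0

-- g is the coefficient function of the Geode G:  S - 1 = (t_2+t_3+...) G,
-- compared coefficientwise
IsGeode : (HType → ℤ) → Set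
IsGeode g = ∀ (m : HType) → (+ Cat m) ℤ.- (+ isZeroType m) ≡ mulSumT g m

-- a · e_j  (the type with a in position j, 0 elsewhere); meant for j ≥ 2
unitT : ℕ → ℕ → HType
unitT j a = replicate (j ∸ 2) 0 ++ (a ∷ [])

_⊕_ : HType → HType → HType
[]       ⊕ ys       = ys
xs       ⊕ []       = xs
(x ∷ xs) ⊕ (y ∷ ys) = (x ℕ.+ y) ∷ (xs ⊕ ys)

-- Comparing coefficients of t^m in S - 1 = (t₂ + t₃ + ⋯) G shows that for every nonzero
-- type m, C(m) is the sum of G(m - e_p) over the positions p with m_p ≥ 1.  On types
-- supported on the two positions j and k this becomes a two-variable recurrence:
-- C((a+1)e_j) = G(a e_j) and C((a+1)e_j + (b+1)e_k) = G(a e_j + (b+1)e_k) + G((a+1)e_j + b e_k).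
-- Solving it for G by induction on the e_k-exponent gives the alternating sum.
module Submission where

open import Defs
open import Data.Nat using (ℕ; suc; _≤_; _+_; _∸_)
open import Data.Integer using (ℤ; +_; -1ℤ; _^_; _*_)
open import Data.List using (map; upTo)
open import Relation.Binary.PropositionalEquality using (_≡_; _≢_)

open import Data.Nat using (zero; _<_; s≤s; z≤n)
open import Data.Nat.Properties as ℕ using (suc-injective)
import Data.Integer as ℤ
open import Data.Integer.Properties as ℤ using ()
open import Data.Integer.Tactic.RingSolver using (solve-∀)
open import Data.List using ([]; _∷_; applyUpTo; length)
open import Data.List.Properties using (map-upTo)
open import Data.Empty using (⊥-elim)
open import Function using (_∘_; _$_)
open import Relation.Binary.PropositionalEquality
  using (refl; sym; trans; cong; cong₂; module ≡-Reasoning)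

sumUpTo : (ℕ → ℤ) → ℕ → ℤ
sumUpTo f n = sumℤ (applyUpTo f n)

sumUpTo-cong : ∀ {f h} n → (∀ i → f i ≡ h i) → sumUpTo f n ≡ sumUpTo h n
sumUpTo-cong zero    f≡h = refl
sumUpTo-cong (suc n) f≡h = cong₂ ℤ._+_ (f≡h 0) (sumUpTo-cong n (f≡h ∘ suc))

sumUpTo-neg : ∀ f n → sumUpTo (ℤ.-_ ∘ f) n ≡ ℤ.- sumUpTo f n
sumUpTo-neg f zero    = refl
sumUpTo-neg f (suc n) = trans (cong (ℤ._+_ (ℤ.- f 0)) (sumUpTo-neg (f ∘ suc) n))
                              (sym (ℤ.neg-distrib-+ (f 0) (sumUpTo (f ∘ suc) n)))

sumUpTo-zero : ∀ f n → (∀ i → f i ≡ + 0) → sumUpTo f n ≡ + 0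
sumUpTo-zero f zero    f≡0 = refl
sumUpTo-zero f (suc n) f≡0 rewrite f≡0 0 =
  trans (ℤ.+-identityˡ _) (sumUpTo-zero (f ∘ suc) n (f≡0 ∘ suc))

suc-≢ : ∀ {p q} → p ≢ q → suc p ≢ suc q
suc-≢ p≢q = p≢q ∘ suc-injective

sumUpTo-single : ∀ f n q → q < n → (∀ p → p ≢ q → f p ≡ + 0) → sumUpTo f n ≡ f q
sumUpTo-single f (suc n) zero    _         f≡0 =
  trans (cong (ℤ._+_ (f 0)) (sumUpTo-zero (f ∘ suc) n (λ p → f≡0 (suc p) λ ())))
        (ℤ.+-identityʳ (f 0))
sumUpTo-single f (suc n) (suc q) (s≤s q<n) f≡0 rewrite f≡0 0 (λ ()) =
  trans (ℤ.+-identityˡ _) $ sumUpTo-single (f ∘ suc) n q q<n (λ p → f≡0 (suc p) ∘ suc-≢)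

sumUpTo-pair : ∀ f n q₁ q₂ → q₁ ≢ q₂ → q₁ < n → q₂ < n →
               (∀ p → p ≢ q₁ → p ≢ q₂ → f p ≡ + 0) → sumUpTo f n ≡ f q₁ ℤ.+ f q₂
sumUpTo-pair f (suc n) zero     zero     q₁≢q₂ _ _ _ = ⊥-elim (q₁≢q₂ refl)
sumUpTo-pair f (suc n) zero     (suc q₂) _ _ (s≤s q₂<n) f≡0 =
  cong (ℤ._+_ (f 0)) (sumUpTo-single (f ∘ suc) n q₂ q₂<n (λ p → f≡0 (suc p) (λ ()) ∘ suc-≢))
sumUpTo-pair f (suc n) (suc q₁) zero     _ (s≤s q₁<n) _ f≡0 =
  trans (cong (ℤ._+_ (f 0)) (sumUpTo-single (f ∘ suc) n q₁ q₁<n (λ p p≢q₁ → f≡0 (suc p) (suc-≢ p≢q₁) (λ ()))))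
        (ℤ.+-comm (f 0) _)
sumUpTo-pair f (suc n) (suc q₁) (suc q₂) q₁≢q₂ (s≤s q₁<n) (s≤s q₂<n) f≡0 rewrite f≡0 0 (λ ()) (λ ()) =
  trans (ℤ.+-identityˡ _) $ sumUpTo-pair (f ∘ suc) n q₁ q₂ (q₁≢q₂ ∘ cong suc) q₁<n q₂<n
    (λ p p≢q₁ p≢q₂ → f≡0 (suc p) (suc-≢ p≢q₁) (suc-≢ p≢q₂))

entry-⊕ : ∀ xs ys p → entry (xs ⊕ ys) p ≡ entry xs p + entry ys p
entry-⊕ []       ys       p       = refl
entry-⊕ (x ∷ xs) []       p       = sym (ℕ.+-identityʳ _)
entry-⊕ (x ∷ xs) (y ∷ ys) zero    = refl
entry-⊕ (x ∷ xs) (y ∷ ys) (suc p) = entry-⊕ xs ys p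

decAt-⊕ˡ : ∀ xs ys p {x} → entry xs p ≡ suc x → decAt p (xs ⊕ ys) ≡ decAt p xs ⊕ ys
decAt-⊕ˡ (_ ∷ xs)       []       zero    _    = refl
decAt-⊕ˡ (_ ∷ xs)       []       (suc p) _    = refl
decAt-⊕ˡ (.(suc _) ∷ _) (y ∷ ys) zero    refl = refl
decAt-⊕ˡ (x ∷ xs)       (y ∷ ys) (suc p) xₚ≡ = cong (x + y ∷_) (decAt-⊕ˡ xs ys p xₚ≡)

decAt-⊕ʳ : ∀ xs ys p {y} → entry ys p ≡ suc y → decAt p (xs ⊕ ys) ≡ xs ⊕ decAt p ys
decAt-⊕ʳ []       ys              p           _    = refl
decAt-⊕ʳ (x ∷ xs) (.(suc y) ∷ ys) zero    {y} refl = cong (λ s → s ∸ 1 ∷ xs ⊕ ys) (ℕ.+-suc x y)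
decAt-⊕ʳ (x ∷ xs) (y ∷ ys)        (suc p)     yₚ≡ = cong (x + y ∷_) (decAt-⊕ʳ xs ys p yₚ≡)

entry≡suc⇒<length : ∀ xs p {x} → entry xs p ≡ suc x → p < length xs
entry≡suc⇒<length (_ ∷ xs) zero    _    = s≤s z≤n
entry≡suc⇒<length (_ ∷ xs) (suc p) xₚ≡ = s≤s (entry≡suc⇒<length xs p xₚ≡)

entry≡suc⇒isZeroType≡0 : ∀ xs p {x} → entry xs p ≡ suc x → isZeroType xs ≡ 0
entry≡suc⇒isZeroType≡0 (.(suc _) ∷ xs) zero    refl = refl
entry≡suc⇒isZeroType≡0 (zero ∷ xs)     (suc p) xₚ≡ = entry≡suc⇒isZeroType≡0 xs p xₚ≡
entry≡suc⇒isZeroType≡0 (suc _ ∷ xs)    (suc p) _    = refl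

entry-unitT : ∀ q a → entry (unitT (2 + q) a) q ≡ a
entry-unitT zero    a = refl
entry-unitT (suc q) a = entry-unitT q a

entry-unitT-≢ : ∀ q a p → p ≢ q → entry (unitT (2 + q) a) p ≡ 0
entry-unitT-≢ zero    a zero    p≢q = ⊥-elim (p≢q refl)
entry-unitT-≢ zero    a (suc p) _   = refl
entry-unitT-≢ (suc q) a zero    _   = refl
entry-unitT-≢ (suc q) a (suc p) p≢q = entry-unitT-≢ q a p (p≢q ∘ cong suc)

entry-unitT-0 : ∀ q p → entry (unitT (2 + q) 0) p ≡ 0
entry-unitT-0 zero    zero    = refl
entry-unitT-0 zero    (suc p) = refl
entry-unitT-0 (suc q) zero    = refl
entry-unitT-0 (suc q) (suc p) = entry-unitT-0 q p

decAt-unitT : ∀ q a → decAt q (unitT (2 + q) (suc a)) ≡ unitT (2 + q) a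
decAt-unitT zero    a = refl
decAt-unitT (suc q) a = cong (0 ∷_) (decAt-unitT q a)

module _ (g : HType → ℤ) where

  term-≡0 : ∀ m p → entry m p ≡ 0 → term g m p ≡ + 0
  term-≡0 m p mₚ≡0 with entry m p
  term-≡0 m p refl | .0 = refl

  term-≡suc : ∀ m p {x} → entry m p ≡ suc x → term g m p ≡ g (decAt p m)
  term-≡suc m p mₚ≡ with entry m p
  term-≡suc m p refl | .(suc _) = refl

  mulSumT-single : ∀ m q {x} → entry m q ≡ suc x → (∀ p → p ≢ q → entry m p ≡ 0) →
                   mulSumT g m ≡ g (decAt q m)
  mulSumT-single m q m_q≡ m≡0 = begin
    mulSumT g m                    ≡⟨ cong sumℤ (map-upTo (term g m) (length m)) ⟩
    sumUpTo (term g m) (length m)  ≡⟨ sumUpTo-single (term g m) (length m) q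
                                        (entry≡suc⇒<length m q m_q≡)
                                        (λ p p≢q → term-≡0 m p (m≡0 p p≢q)) ⟩
    term g m q                     ≡⟨ term-≡suc m q m_q≡ ⟩
    g (decAt q m)                  ∎
    where open ≡-Reasoning

  mulSumT-pair : ∀ m q₁ q₂ {x₁ x₂} → q₁ ≢ q₂ → entry m q₁ ≡ suc x₁ → entry m q₂ ≡ suc x₂ →
                 (∀ p → p ≢ q₁ → p ≢ q₂ → entry m p ≡ 0) →
                 mulSumT g m ≡ g (decAt q₁ m) ℤ.+ g (decAt q₂ m)
  mulSumT-pair m q₁ q₂ q₁≢q₂ m_q₁≡ m_q₂≡ m≡0 = begin
    mulSumT g m                    ≡⟨ cong sumℤ (map-upTo (term g m) (length m)) ⟩
    sumUpTo (term g m) (length m)  ≡⟨ sumUpTo-pair (term g m) (length m) q₁ q₂ q₁≢q₂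
                                        (entry≡suc⇒<length m q₁ m_q₁≡)
                                        (entry≡suc⇒<length m q₂ m_q₂≡)
                                        (λ p p≢q₁ p≢q₂ → term-≡0 m p (m≡0 p p≢q₁ p≢q₂)) ⟩
    term g m q₁ ℤ.+ term g m q₂    ≡⟨ cong₂ ℤ._+_ (term-≡suc m q₁ m_q₁≡) (term-≡suc m q₂ m_q₂≡) ⟩
    g (decAt q₁ m) ℤ.+ g (decAt q₂ m) ∎
    where open ≡-Reasoning

  Cat≡mulSumT : IsGeode g → ∀ m p {x} → entry m p ≡ suc x → + Cat m ≡ mulSumT g m
  Cat≡mulSumT isGeode m p mₚ≡ = begin
    + Cat m                             ≡⟨ ℤ.+-identityʳ (+ Cat m) ⟨
    + Cat m ℤ.- + 0                     ≡⟨ cong (λ z → + Cat m ℤ.- + z) (entry≡suc⇒isZeroType≡0 m p mₚ≡) ⟨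
    + Cat m ℤ.- + isZeroType m          ≡⟨ isGeode m ⟩
    mulSumT g m                         ∎
    where open ≡-Reasoning

alternatingTerm : (ℕ → ℕ → ℤ) → ℕ → ℕ → ℕ → ℤ
alternatingTerm c a n i = (-1ℤ ^ i) * c (a + 1 + i) (n ∸ i)

alternatingTerm-zero : ∀ c a n → alternatingTerm c a n 0 ≡ c (suc a) n
alternatingTerm-zero c a n = begin
  (-1ℤ ^ 0) * c (a + 1 + 0) n  ≡⟨ ℤ.*-identityˡ _ ⟩
  c (a + 1 + 0) n              ≡⟨ cong (λ s → c s n) (ℕ.+-identityʳ (a + 1)) ⟩
  c (a + 1) n                  ≡⟨ cong (λ s → c s n) (ℕ.+-comm a 1) ⟩
  c (suc a) n                  ∎
  where open ≡-Reasoning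

alternatingTerm-suc : ∀ c a n i → alternatingTerm c a (suc n) (suc i) ≡ ℤ.- alternatingTerm c (suc a) n i
alternatingTerm-suc c a n i = begin
  (-1ℤ ^ suc i) * c (a + 1 + suc i) (n ∸ i)        ≡⟨ cong (λ s → (-1ℤ ^ suc i) * c s (n ∸ i)) (ℕ.+-suc (a + 1) i) ⟩
  (-1ℤ * (-1ℤ ^ i)) * c (suc a + 1 + i) (n ∸ i)    ≡⟨ ℤ.*-assoc -1ℤ (-1ℤ ^ i) _ ⟩
  -1ℤ * ((-1ℤ ^ i) * c (suc a + 1 + i) (n ∸ i))    ≡⟨ ℤ.-1*i≡-i _ ⟩
  ℤ.- ((-1ℤ ^ i) * c (suc a + 1 + i) (n ∸ i))      ∎
  where open ≡-Reasoning

x≡[x+y]-y : ∀ x y → x ≡ (x ℤ.+ y) ℤ.- y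
x≡[x+y]-y = solve-∀

module _ (c h : ℕ → ℕ → ℤ)
         (c≡h-zero : ∀ a → c (suc a) 0 ≡ h a 0)
         (c≡h+h-suc : ∀ a b → c (suc a) (suc b) ≡ h a (suc b) ℤ.+ h (suc a) b) where

  h≡alternatingSum : ∀ n a → h a n ≡ sumUpTo (alternatingTerm c a n) (suc n)
  h≡alternatingSum zero a = begin
    h a 0                              ≡⟨ c≡h-zero a ⟨
    c (suc a) 0                        ≡⟨ alternatingTerm-zero c a 0 ⟨
    alternatingTerm c a 0 0            ≡⟨ ℤ.+-identityʳ _ ⟨
    sumUpTo (alternatingTerm c a 0) 1  ∎
    where open ≡-Reasoning
  h≡alternatingSum (suc n) a = begin
    h a (suc n)
      ≡⟨ x≡[x+y]-y (h a (suc n)) (h (suc a) n) ⟩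
    (h a (suc n) ℤ.+ h (suc a) n) ℤ.- h (suc a) n
      ≡⟨ cong₂ ℤ._-_ (sym (c≡h+h-suc a n)) (h≡alternatingSum n (suc a)) ⟩
    c (suc a) (suc n) ℤ.- sumUpTo (alternatingTerm c (suc a) n) (suc n)
      ≡⟨ cong₂ ℤ._+_ (alternatingTerm-zero c a (suc n)) (sumUpTo-neg (alternatingTerm c (suc a) n) (suc n)) ⟨
    alternatingTerm c a (suc n) 0 ℤ.+ sumUpTo (ℤ.-_ ∘ alternatingTerm c (suc a) n) (suc n)
      ≡⟨ cong (ℤ._+_ (alternatingTerm c a (suc n) 0)) (sumUpTo-cong (suc n) (alternatingTerm-suc c a n)) ⟨
    sumUpTo (alternatingTerm c a (suc n)) (suc (suc n))
      ∎
    where open ≡-Reasoning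

module TwoPositionTypes (g : HType → ℤ) (isGeode : IsGeode g) {qj qk : ℕ} (qj≢qk : qj ≢ qk) where

  twoPos : ℕ → ℕ → HType
  twoPos a b = unitT (2 + qj) a ⊕ unitT (2 + qk) b

  entry-twoPos-j : ∀ a b → entry (twoPos a b) qj ≡ a
  entry-twoPos-j a b = begin
    entry (twoPos a b) qj                                    ≡⟨ entry-⊕ (unitT (2 + qj) a) _ qj ⟩
    entry (unitT (2 + qj) a) qj + entry (unitT (2 + qk) b) qj ≡⟨ cong₂ _+_ (entry-unitT qj a) (entry-unitT-≢ qk b qj qj≢qk) ⟩
    a + 0                                                    ≡⟨ ℕ.+-identityʳ a ⟩
    a                                                        ∎
    where open ≡-Reasoning

  entry-twoPos-k : ∀ a b → entry (twoPos a b) qk ≡ b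
  entry-twoPos-k a b = trans (entry-⊕ (unitT (2 + qj) a) _ qk)
                             (cong₂ _+_ (entry-unitT-≢ qj a qk (qj≢qk ∘ sym)) (entry-unitT qk b))

  entry-twoPos-≢ : ∀ a b p → p ≢ qj → p ≢ qk → entry (twoPos a b) p ≡ 0
  entry-twoPos-≢ a b p p≢qj p≢qk = trans (entry-⊕ (unitT (2 + qj) a) _ p)
                                         (cong₂ _+_ (entry-unitT-≢ qj a p p≢qj) (entry-unitT-≢ qk b p p≢qk))

  entry-twoPos-0 : ∀ a p → p ≢ qj → entry (twoPos a 0) p ≡ 0
  entry-twoPos-0 a p p≢qj = trans (entry-⊕ (unitT (2 + qj) a) _ p)
                                  (cong₂ _+_ (entry-unitT-≢ qj a p p≢qj) (entry-unitT-0 qk p))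

  decAt-twoPos-j : ∀ a b → decAt qj (twoPos (suc a) b) ≡ twoPos a b
  decAt-twoPos-j a b = trans (decAt-⊕ˡ (unitT (2 + qj) (suc a)) _ qj (entry-unitT qj (suc a)))
                             (cong (_⊕ unitT (2 + qk) b) (decAt-unitT qj a))

  decAt-twoPos-k : ∀ a b → decAt qk (twoPos a (suc b)) ≡ twoPos a b
  decAt-twoPos-k a b = trans (decAt-⊕ʳ (unitT (2 + qj) a) _ qk (entry-unitT qk (suc b)))
                             (cong (unitT (2 + qj) a ⊕_) (decAt-unitT qk b))

  Cat-twoPos-zero : ∀ a → + Cat (twoPos (suc a) 0) ≡ g (twoPos a 0)
  Cat-twoPos-zero a = begin
    + Cat m            ≡⟨ Cat≡mulSumT g isGeode m qj (entry-twoPos-j (suc a) 0) ⟩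
    mulSumT g m        ≡⟨ mulSumT-single g m qj (entry-twoPos-j (suc a) 0) (entry-twoPos-0 (suc a)) ⟩
    g (decAt qj m)     ≡⟨ cong g (decAt-twoPos-j a 0) ⟩
    g (twoPos a 0)     ∎
    where
      open ≡-Reasoning
      m : HType
      m = twoPos (suc a) 0

  Cat-twoPos-suc : ∀ a b → + Cat (twoPos (suc a) (suc b)) ≡ g (twoPos a (suc b)) ℤ.+ g (twoPos (suc a) b)
  Cat-twoPos-suc a b = begin
    + Cat m                                    ≡⟨ Cat≡mulSumT g isGeode m qj (entry-twoPos-j (suc a) (suc b)) ⟩
    mulSumT g m                                ≡⟨ mulSumT-pair g m qj qk qj≢qk
                                                    (entry-twoPos-j (suc a) (suc b))
                                                    (entry-twoPos-k (suc a) (suc b))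
                                                    (entry-twoPos-≢ (suc a) (suc b)) ⟩
    g (decAt qj m) ℤ.+ g (decAt qk m)          ≡⟨ cong₂ ℤ._+_ (cong g (decAt-twoPos-j a (suc b)))
                                                              (cong g (decAt-twoPos-k (suc a) b)) ⟩
    g (twoPos a (suc b)) ℤ.+ g (twoPos (suc a) b) ∎
    where
      open ≡-Reasoning
      m : HType
      m = twoPos (suc a) (suc b)

  Cat-twoPos : ℕ → ℕ → ℤ
  Cat-twoPos a b = + Cat (twoPos a b)

  g-twoPos : ∀ n a → g (twoPos a n) ≡ sumUpTo (alternatingTerm Cat-twoPos a n) (suc n)
  g-twoPos = h≡alternatingSum Cat-twoPos (λ a b → g (twoPos a b)) Cat-twoPos-zero Cat-twoPos-suc

theorem11 : (g : HType → ℤ) → IsGeode g →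
    (j k : ℕ) → 2 ≤ j → 2 ≤ k → j ≢ k →
    (m n : ℕ) → 1 ≤ m → 1 ≤ n →
    g (unitT j m ⊕ unitT k n)
      ≡ sumℤ (map (λ i → (-1ℤ ^ i) * (+ Cat (unitT j (m + 1 + i) ⊕ unitT k (n ∸ i))))
                  (upTo (suc n)))
theorem11 g isGeode (suc (suc qj)) (suc (suc qk)) (s≤s (s≤s z≤n)) (s≤s (s≤s z≤n)) j≢k m n _ _ =
  trans (g-twoPos n m) (sym (cong sumℤ (map-upTo (alternatingTerm Cat-twoPos m n) (suc n))))
  where open TwoPositionTypes g isGeode (j≢k ∘ cong (suc ∘ suc))
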